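{- Let $p$ be a prime, $q=p^m$, and for $j\in\mathrm{GF}(p)$ let $B_j=\{u\in\mathrm{GF}(q):\mathrm{Tr}(u)=j\}$. Then the setwise stabiliser of $B_j$ in $\mathrm{GA}_1(q)=\{x\mapsto ax+b:a\in\mathrm{GF}(q)^*,b\in\mathrm{GF}(q)\}$ is $$G_{B_j}=\{x\mapsto ax+b:\ a\in\mathrm{GF}(p)^*,\ b\in B_{j-ja}\},$$ and $|G_{B_j}|=(p-1)p^{m-1}$.
   Context: $\mathrm{Tr}$ denotes the absolute trace from $\mathrm{GF}(p^m)$ to $\mathrm{GF}(p)$. -}

module Defs where

open import Level using (0ℓ)
open import Data.Nat using (ℕ; zero; suc; _^_)
open import Data.Fin using (Fin; toℕ)
open import Data.Product using (Σ; ∃; _×_; _,_)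
open import Relation.Binary.PropositionalEquality using (_≡_)
open import Relation.Nullary using (¬_)
open import Algebra.Structures using (IsCommutativeRing)
open import Function.Bundles using (_↔_)

record FiniteField : Set₁ where
  infixl 6 _+_ _-_
  infixl 7 _*_
  field
    Carrier : Set
    _+_ _*_ : Carrier → Carrier → Carrier
    -_      : Carrier → Carrier
    0# 1#   : Carrier
    isCommutativeRing : IsCommutativeRing _≡_ _+_ _*_ -_ 0# 1#
    0≢1     : ¬ (0# ≡ 1#)
    inverse : ∀ x → ¬ (x ≡ 0#) → ∃ λ y → x * y ≡ 1#
    size    : ℕ
    enum    : Carrier ↔ Fin size

  _-_ : Carrier → Carrier → Carrier
  x - y = x + (- y)

  pow : Carrier → ℕ → Carrier
  pow x zero    = 1#
  pow x (suc n) = x * pow x n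

  ι : ℕ → Carrier
  ι zero    = 0#
  ι (suc n) = 1# + ι n

  -- Absolute trace GF(p^m) → GF(p):  Tr(u) = Σ_{i<m} u^(p^i)
  -- (valued in the prime subfield, viewed inside the carrier)
  Tr : (p m : ℕ) → Carrier → Carrier
  Tr p zero    u = 0#
  Tr p (suc i) u = Tr p i u + pow u (p ^ i)

  InPrimeField : (p : ℕ) → Carrier → Set
  InPrimeField p a = ∃ λ (k : Fin p) → a ≡ ι (toℕ k)

  InB : (p m : ℕ) → Carrier → Carrier → Set
  InB p m j u = Tr p m u ≡ j

  Stabilises : (p m : ℕ) → Carrier → Carrier → Carrier → Set
  Stabilises p m j a b =
    (∀ u → InB p m j u → InB p m j (a * u + b)) ×
    (∀ v → InB p m j v → ∃ λ u → InB p m j u × a * u + b ≡ v)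

  InStabiliser : (p m : ℕ) → Carrier → Carrier × Carrier → Set
  InStabiliser p m j (a , b) = ¬ (a ≡ 0#) × Stabilises p m j a b

module Submission where

-- With Tr w₀ = 1 every u
--    splits as (u − Tr(u)·w₀) + Tr(u)·w₀, so each fibre of Tr is a translate of
--    the kernel, and |ker Tr| = p^(m−1).
--  * Stabiliser: x ↦ a x + b stabilises B_j iff a ∈ GF(p)* and Tr b = j − j a.
--    Such a map preserves ker Tr, which forces a = Tr(a w₀) ∈ GF(p); the converse
--    is linearity.

open import Defs
open import Data.Nat using (ℕ; _^_)
import Data.Nat as N
open import Data.Nat.Primality using (Prime)
open import Data.Fin using (Fin; toℕ)
open import Data.Product using (Σ; ∃; _×_; _,_)
open import Data.List using (List; length)
open import Data.List.Relation.Unary.Unique.Propositional using (Unique)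
open import Data.List.Membership.Propositional using (_∈_)
open import Relation.Binary.PropositionalEquality using (_≡_)
open import Relation.Nullary using (¬_)
open import Function.Bundles using (_⇔_)
open import Data.Empty using (⊥-elim)

module ListCounting where
  open import Data.Nat using (_*_)
  open import Data.List using ([]; _∷_; map; cartesianProduct)
  import Data.List.Properties as LP
  open import Data.List.Membership.Propositional.Properties.WithK using (unique∧set⇒bag)
  open import Data.List.Relation.Binary.BagAndSetEquality using (∼bag⇒↭)
  open import Data.List.Relation.Binary.Permutation.Propositional.Properties using (↭-length)
  open import Relation.Binary.PropositionalEquality using (refl; trans; cong₂)

  length-cartesianProduct : {A B : Set} (xs : List A) (ys : List B) →
                            length (cartesianProduct xs ys) ≡ length xs * length ys
  length-cartesianProduct [] ys = refl
  length-cartesianProduct (x ∷ xs) ys =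
    trans (LP.length-++ (map (x ,_) ys))
          (cong₂ N._+_ (LP.length-map (x ,_) ys) (length-cartesianProduct xs ys))

  same-members⇒same-length : {A : Set} {xs ys : List A} → Unique xs → Unique ys →
                             (∀ {z} → z ∈ xs ⇔ z ∈ ys) → length xs ≡ length ys
  same-members⇒same-length uxs uys same = ↭-length (∼bag⇒↭ (unique∧set⇒bag uxs uys same))

module BinomialDivisibility where
  open import Data.Nat using (zero; suc; _*_; _∸_; _<_; _!)
  import Data.Nat.Properties as NP
  open import Data.Nat.Divisibility using (_∣_; ∣⇒≤; ∣1⇒≡1; m∣m*n)
  open import Data.Nat.DivMod using (m/n*n≡m)
  open import Data.Nat.Primality using (euclidsLemma; ¬prime[1])
  open import Data.Nat.Combinatorics using (_C_; nCk≡n!/k![n-k]!; k![n∸k]!∣n!)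
  open import Data.Sum using (inj₁; inj₂)
  open import Relation.Binary.PropositionalEquality using (refl; sym; trans; cong; subst)

  prime∤factorial : ∀ {p} → Prime p → ∀ k → k < p → ¬ (p ∣ k !)
  prime∤factorial pp zero k<p p∣1 with ∣1⇒≡1 p∣1
  ... | refl = ¬prime[1] pp
  prime∤factorial pp (suc k) k<p p∣k! with euclidsLemma (suc k) (k !) pp p∣k!
  ... | inj₁ p∣1+k = NP.<⇒≱ k<p (∣⇒≤ p∣1+k)
  ... | inj₂ p∣k!  = prime∤factorial pp k (NP.<-trans (NP.n<1+n k) k<p) p∣k!

  -- (p choose k) · k! (p−k)! = p! is a multiple of p, and p divides neither factorial.
  prime∣binomial : ∀ {p} → Prime p → ∀ k → 0 < k → k < p → p ∣ (p C k)
  prime∣binomial {suc p'} pp k 0<k k<p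
    with euclidsLemma (p C k) (k ! * (p ∸ k) !) pp p∣product
    where
    p = suc p'
    instance _ = NP._!*_!≢0 k (p ∸ k)
    p∣product : p ∣ (p C k) * (k ! * (p ∸ k) !)
    p∣product = subst (p ∣_)
      (sym (trans (cong (_* (k ! * (p ∸ k) !)) (nCk≡n!/k![n-k]! (NP.<⇒≤ k<p)))
                  (m/n*n≡m (k![n∸k]!∣n! (NP.<⇒≤ k<p)))))
      (m∣m*n (p' !))
  ... | inj₁ p∣C = p∣C
  ... | inj₂ p∣k![p-k]! with euclidsLemma (k !) ((suc p' ∸ k) !) pp p∣k![p-k]!
  ...   | inj₁ p∣k!     = ⊥-elim (prime∤factorial pp k k<p p∣k!)
  ...   | inj₂ p∣[p-k]! = ⊥-elim (prime∤factorial pp (suc p' ∸ k)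
                                     (NP.∸-monoʳ-< 0<k (NP.<⇒≤ k<p)) p∣[p-k]!)

module FieldArithmetic (F : FiniteField) where
  open import Level using (0ℓ)
  open import Data.Nat using (zero; suc)
  open import Data.Integer as Z using (ℤ)
  import Data.Integer.Properties as ZP
  import Data.Sign as Sign
  import Data.Fin.Properties as FinP
  open import Data.Maybe using (Maybe; nothing; just)
  open import Data.Product using (proj₁; proj₂)
  open import Relation.Binary.PropositionalEquality
  open import Relation.Nullary using (Dec; yes; no)
  open import Function.Bundles using (Injection; Inverse)
  open import Function.Properties.Inverse using (↔⇒↣)
  open import Algebra.Bundles using (CommutativeRing; AbelianGroup; Ring)
  open import Algebra.Structures using (IsCommutativeRing)
  open import Algebra.Solver.Ring.AlmostCommutativeRing
    using (AlmostCommutativeRing; fromCommutativeRing; _-Raw-AlmostCommutative⟶_)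

  open FiniteField F public
  open IsCommutativeRing isCommutativeRing public
    using ( +-assoc; +-comm; +-identityˡ; +-identityʳ; -‿inverseʳ
          ; *-assoc; *-comm; *-identityˡ; *-identityʳ; distribˡ; distribʳ; zeroˡ; zeroʳ )

  ring : CommutativeRing 0ℓ 0ℓ
  ring = record { isCommutativeRing = isCommutativeRing }

  open import Algebra.Properties.RingWithoutOne (Ring.ringWithoutOne (CommutativeRing.ring ring))
    public using (-‿distribˡ-*; -‿distribʳ-*)
  open import Algebra.Properties.AbelianGroup (CommutativeRing.+-abelianGroup ring)
    using (⁻¹-∙-comm)
  open import Algebra.Properties.Group (AbelianGroup.group (CommutativeRing.+-abelianGroup ring))
    using (⁻¹-involutive; ε⁻¹≈ε)
  open ≡-Reasoning

  _≟_ : (x y : Carrier) → Dec (x ≡ y)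
  x ≟ y with Inverse.to enum x FinP.≟ Inverse.to enum y
  ... | yes eq = yes (Injection.injective (↔⇒↣ enum) eq)
  ... | no ne  = no (λ x≡y → ne (cong (Inverse.to enum) x≡y))

  ι-+ : ∀ m n → ι (m N.+ n) ≡ ι m + ι n
  ι-+ zero    n = sym (+-identityˡ _)
  ι-+ (suc m) n = trans (cong (1# +_) (ι-+ m n)) (sym (+-assoc _ _ _))

  ι-* : ∀ m n → ι (m N.* n) ≡ ι m * ι n
  ι-* zero    n = sym (zeroˡ _)
  ι-* (suc m) n = begin
    ι (n N.+ m N.* n)      ≡⟨ ι-+ n (m N.* n) ⟩
    ι n + ι (m N.* n)      ≡⟨ cong₂ _+_ (sym (*-identityˡ _)) (ι-* m n) ⟩
    1# * ι n + ι m * ι n   ≡⟨ sym (distribʳ _ _ _) ⟩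
    (1# + ι m) * ι n       ∎

  -- Its extension to the canonical ring homomorphism ℤ → F supplies the
  -- coefficients of the ring solver used for routine identities below.
  ιℤ : ℤ → Carrier
  ιℤ (Z.+ n)    = ι n
  ιℤ Z.-[1+ n ] = - ι (suc n)

  private
    neg-+ : ∀ x y → - (x + y) ≡ - x + - y
    neg-+ x y = sym (⁻¹-∙-comm x y)

    neg-neg-* : ∀ x y → (- x) * (- y) ≡ x * y
    neg-neg-* x y = begin
      (- x) * (- y)  ≡⟨ sym (-‿distribˡ-* x (- y)) ⟩
      - (x * - y)    ≡⟨ cong -_ (sym (-‿distribʳ-* x y)) ⟩
      - (- (x * y))  ≡⟨ ⁻¹-involutive _ ⟩
      x * y          ∎

    ιℤ-⊖ : ∀ m n → ιℤ (m Z.⊖ n) ≡ ι m + - ι n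
    ιℤ-⊖ zero    zero    = sym (-‿inverseʳ 0#)
    ιℤ-⊖ zero    (suc n) = sym (+-identityˡ _)
    ιℤ-⊖ (suc m) zero    = sym (trans (cong (ι (suc m) +_) ε⁻¹≈ε) (+-identityʳ _))
    ιℤ-⊖ (suc m) (suc n) = begin
      ιℤ (suc m Z.⊖ suc n)          ≡⟨ cong ιℤ (ZP.[1+m]⊖[1+n]≡m⊖n m n) ⟩
      ιℤ (m Z.⊖ n)                  ≡⟨ ιℤ-⊖ m n ⟩
      ι m + - ι n                   ≡⟨ sym (cancel-1 (ι m) (ι n)) ⟩
      ι (suc m) + - ι (suc n)       ∎
      where
      cancel-1 : ∀ a b → (1# + a) + - (1# + b) ≡ a + - b
      cancel-1 a b = begin
        (1# + a) + - (1# + b)        ≡⟨ cong₂ _+_ (+-comm 1# a) (neg-+ 1# b) ⟩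
        (a + 1#) + (- 1# + - b)      ≡⟨ +-assoc a 1# _ ⟩
        a + (1# + (- 1# + - b))      ≡⟨ cong (a +_) (sym (+-assoc 1# (- 1#) (- b))) ⟩
        a + ((1# + - 1#) + - b)      ≡⟨ cong (λ t → a + (t + - b)) (-‿inverseʳ 1#) ⟩
        a + (0# + - b)               ≡⟨ cong (a +_) (+-identityˡ _) ⟩
        a + - b                      ∎

    ιℤ-+ : ∀ i j → ιℤ (i Z.+ j) ≡ ιℤ i + ιℤ j
    ιℤ-+ (Z.+ m)    (Z.+ n)    = ι-+ m n
    ιℤ-+ (Z.+ m)    Z.-[1+ n ] = ιℤ-⊖ m (suc n)
    ιℤ-+ Z.-[1+ m ] (Z.+ n)    = trans (ιℤ-⊖ n (suc m)) (+-comm _ _)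
    ιℤ-+ Z.-[1+ m ] Z.-[1+ n ] = begin
      - (1# + ι (suc (m N.+ n)))      ≡⟨ cong (λ t → - (1# + t)) (ι-+ (suc m) n) ⟩
      - (1# + (ι (suc m) + ι n))      ≡⟨ cong -_ (swap-1 (ι (suc m)) (ι n)) ⟩
      - (ι (suc m) + (1# + ι n))      ≡⟨ neg-+ _ _ ⟩
      - ι (suc m) + - ι (suc n)       ∎
      where
      swap-1 : ∀ a b → 1# + (a + b) ≡ a + (1# + b)
      swap-1 a b = trans (sym (+-assoc 1# a b))
                         (trans (cong (_+ b) (+-comm 1# a)) (+-assoc a 1# b))

    ιℤ-neg : ∀ i → ιℤ (Z.- i) ≡ - ιℤ i
    ιℤ-neg (Z.+ zero)    = sym ε⁻¹≈ε
    ιℤ-neg (Z.+ suc n)   = refl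
    ιℤ-neg Z.-[1+ n ]    = sym (⁻¹-involutive _)

    ιℤ-◃+ : ∀ n → ιℤ (Sign.+ Z.◃ n) ≡ ι n
    ιℤ-◃+ zero    = refl
    ιℤ-◃+ (suc n) = refl

    ιℤ-◃- : ∀ n → ιℤ (Sign.- Z.◃ n) ≡ - ι n
    ιℤ-◃- zero    = sym ε⁻¹≈ε
    ιℤ-◃- (suc n) = refl

    ιℤ-* : ∀ i j → ιℤ (i Z.* j) ≡ ιℤ i * ιℤ j
    ιℤ-* (Z.+ m)    (Z.+ n)    = trans (ιℤ-◃+ (m N.* n)) (ι-* m n)
    ιℤ-* (Z.+ m)    Z.-[1+ n ] =
      trans (ιℤ-◃- (m N.* suc n)) (trans (cong -_ (ι-* m (suc n))) (-‿distribʳ-* _ _))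
    ιℤ-* Z.-[1+ m ] (Z.+ n)    =
      trans (ιℤ-◃- (suc m N.* n)) (trans (cong -_ (ι-* (suc m) n)) (-‿distribˡ-* _ _))
    ιℤ-* Z.-[1+ m ] Z.-[1+ n ] =
      trans (ιℤ-◃+ (suc m N.* suc n)) (trans (ι-* (suc m) (suc n)) (sym (neg-neg-* _ _)))

    ιℤ-hom : Z.+-*-rawRing -Raw-AlmostCommutative⟶ fromCommutativeRing ring
    ιℤ-hom = record
      { ⟦_⟧ = ιℤ ; +-homo = ιℤ-+ ; *-homo = ιℤ-* ; -‿homo = ιℤ-neg
      ; 0-homo = refl ; 1-homo = +-identityʳ 1# }

    ιℤ-equal? : ∀ i j → Maybe (ιℤ i ≡ ιℤ j)
    ιℤ-equal? i j with i Z.≟ j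
    ... | yes i≡j = just (cong ιℤ i≡j)
    ... | no _    = nothing

  open import Algebra.Solver.Ring Z.+-*-rawRing (fromCommutativeRing ring) ιℤ-hom ιℤ-equal?
    public using (solve; _:=_; _:+_; _:*_; :-_; _:-_)

  +-cancelʳ : ∀ t {x y} → x + t ≡ y + t → x ≡ y
  +-cancelʳ t {x} {y} x+t≡y+t = begin
    x              ≡⟨ solve 2 (λ x t → x := (x :+ t) :- t) refl x t ⟩
    (x + t) - t    ≡⟨ cong (_- t) x+t≡y+t ⟩
    (y + t) - t    ≡⟨ solve 2 (λ y t → (y :+ t) :- t := y) refl y t ⟩
    y              ∎

  1≢0 : ¬ (1# ≡ 0#)
  1≢0 e = 0≢1 (sym e)

  inv : ∀ x → ¬ (x ≡ 0#) → Carrier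
  inv x x≢0 = proj₁ (inverse x x≢0)

  inv-r : ∀ x (x≢0 : ¬ (x ≡ 0#)) → x * inv x x≢0 ≡ 1#
  inv-r x x≢0 = proj₂ (inverse x x≢0)

  *-inv-cancel : ∀ a (a≢0 : ¬ (a ≡ 0#)) x → a * (inv a a≢0 * x) ≡ x
  *-inv-cancel a a≢0 x = begin
    a * (inv a a≢0 * x)   ≡⟨ sym (*-assoc _ _ _) ⟩
    (a * inv a a≢0) * x   ≡⟨ cong (_* x) (inv-r a a≢0) ⟩
    1# * x                ≡⟨ *-identityˡ x ⟩
    x                     ∎

  inv-*-cancel : ∀ a (a≢0 : ¬ (a ≡ 0#)) x → inv a a≢0 * (a * x) ≡ x
  inv-*-cancel a a≢0 x =
    trans (solve 3 (λ b a x → b :* (a :* x) := a :* (b :* x)) refl _ a x) (*-inv-cancel a a≢0 x)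

  cancelˡ : ∀ a {x y} → ¬ (a ≡ 0#) → a * x ≡ a * y → x ≡ y
  cancelˡ a {x} {y} a≢0 ax≡ay = begin
    x                        ≡⟨ sym (inv-*-cancel a a≢0 x) ⟩
    inv a a≢0 * (a * x)      ≡⟨ cong (inv a a≢0 *_) ax≡ay ⟩
    inv a a≢0 * (a * y)      ≡⟨ inv-*-cancel a a≢0 y ⟩
    y                        ∎

  *-nonzero : ∀ {a b} → ¬ (a ≡ 0#) → ¬ (b ≡ 0#) → ¬ (a * b ≡ 0#)
  *-nonzero {a} a≢0 b≢0 ab≡0 = b≢0 (cancelˡ a a≢0 (trans ab≡0 (sym (zeroʳ a))))

  pow-+ : ∀ x m n → pow x (m N.+ n) ≡ pow x m * pow x n
  pow-+ x zero    n = sym (*-identityˡ _)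
  pow-+ x (suc m) n = trans (cong (x *_) (pow-+ x m n)) (sym (*-assoc _ _ _))

  pow-* : ∀ x m n → pow x (m N.* n) ≡ pow (pow x n) m
  pow-* x zero    n = refl
  pow-* x (suc m) n = trans (pow-+ x n (m N.* n)) (cong (pow x n *_) (pow-* x m n))

  pow-distrib-* : ∀ x y n → pow (x * y) n ≡ pow x n * pow y n
  pow-distrib-* x y zero    = sym (*-identityˡ 1#)
  pow-distrib-* x y (suc n) = trans (cong ((x * y) *_) (pow-distrib-* x y n))
    (solve 4 (λ x y a b → (x :* y) :* (a :* b) := (x :* a) :* (y :* b)) refl x y _ _)

  pow-1# : ∀ n → pow 1# n ≡ 1#
  pow-1# zero    = refl
  pow-1# (suc n) = trans (*-identityˡ _) (pow-1# n)

  pow-one : ∀ x → pow x 1 ≡ x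
  pow-one x = *-identityʳ x

  pow-nonzero : ∀ {x} n → ¬ (x ≡ 0#) → ¬ (pow x n ≡ 0#)
  pow-nonzero zero    x≢0 = 1≢0
  pow-nonzero (suc n) x≢0 = *-nonzero x≢0 (pow-nonzero n x≢0)

  pow≡0⇒≡0 : ∀ {x} n → pow x n ≡ 0# → x ≡ 0#
  pow≡0⇒≡0 {x} n xⁿ≡0 with x ≟ 0#
  ... | yes x≡0 = x≡0
  ... | no  x≢0 = ⊥-elim (pow-nonzero n x≢0 xⁿ≡0)

  pow-0# : ∀ {n} → 0 N.< n → pow 0# n ≡ 0#
  pow-0# {suc n} _ = zeroˡ _

  ι-pow : ∀ a m → ι (a N.^ m) ≡ pow (ι a) m
  ι-pow a zero    = +-identityʳ 1#
  ι-pow a (suc m) = trans (ι-* a (a N.^ m)) (cong (ι a *_) (ι-pow a m))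

-- Polynomials over F as coefficient lists (constant term first), and the
-- bound on the number of roots.
module Polynomials (F : FiniteField) where
  open FieldArithmetic F
  open import Data.Nat using (zero; suc; _<_; z≤n; s≤s)
  open import Data.List using ([]; _∷_)
  open import Data.List.Relation.Unary.All using (All; []; _∷_)
  open import Data.List.Relation.Unary.AllPairs using ([]; _∷_)
  open import Data.Empty using (⊥)
  open import Relation.Binary.PropositionalEquality
  open ≡-Reasoning

  Poly : Set
  Poly = List Carrier

  eval : Poly → Carrier → Carrier
  eval []      x = 0#
  eval (c ∷ P) x = c + x * eval P x

  LeadingNonzero : Poly → Set
  LeadingNonzero []          = ⊥
  LeadingNonzero (c ∷ [])    = ¬ (c ≡ 0#)
  LeadingNonzero (c ∷ d ∷ P) = LeadingNonzero (d ∷ P)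

  -- Synthetic division by X − r, with remainder P(r).
  quotient : Carrier → Poly → Poly
  quotient r []          = []
  quotient r (c ∷ [])    = []
  quotient r (c ∷ d ∷ P) = eval (d ∷ P) r ∷ quotient r (d ∷ P)

  remainder-theorem : ∀ r P x → eval P x ≡ (x - r) * eval (quotient r P) x + eval P r
  remainder-theorem r [] x = sym (trans (cong (_+ 0#) (zeroʳ _)) (+-identityˡ 0#))
  remainder-theorem r (c ∷ []) x =
    solve 4 (λ x r c z → c :+ x :* z := (x :- r) :* z :+ (c :+ r :* z)) refl x r c 0#
  remainder-theorem r (c ∷ d ∷ P) x = begin
    c + x * eval (d ∷ P) x          ≡⟨ cong (λ w → c + x * w) (remainder-theorem r (d ∷ P) x) ⟩
    c + x * ((x - r) * Q + A)       ≡⟨ solve 5 (λ c x r Q A → c :+ x :* ((x :- r) :* Q :+ A)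
                                          := (x :- r) :* (A :+ x :* Q) :+ (c :+ r :* A)) refl c x r Q A ⟩
    (x - r) * (A + x * Q) + (c + r * A) ∎
    where
    Q = eval (quotient r (d ∷ P)) x
    A = eval (d ∷ P) r

  quotient-leading : ∀ r c d P → LeadingNonzero (c ∷ d ∷ P) → LeadingNonzero (quotient r (c ∷ d ∷ P))
  quotient-leading r c d []      d≢0 =
    subst (λ w → ¬ (w ≡ 0#)) (sym (trans (cong (d +_) (zeroʳ r)) (+-identityʳ d))) d≢0
  quotient-leading r c d (e ∷ P) lead = quotient-leading r d e P lead

  quotient-length : ∀ r c d P → length (quotient r (c ∷ d ∷ P)) ≡ suc (length P)
  quotient-length r c d []      = refl
  quotient-length r c d (e ∷ P) = cong suc (quotient-length r d e P)

  root-bound : ∀ P → LeadingNonzero P → (rs : List Carrier) → Unique rs →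
               All (λ x → eval P x ≡ 0#) rs → length rs < length P
  root-bound (c ∷ P)     lead []       _ _ = s≤s z≤n
  root-bound (c ∷ [])    c≢0  (x ∷ rs) _ (root ∷ _) =
    ⊥-elim (c≢0 (trans (sym (trans (cong (c +_) (zeroʳ x)) (+-identityʳ c))) root))
  root-bound (c ∷ d ∷ P) lead (x ∷ rs) (x∉rs ∷ u) (root ∷ roots) =
    s≤s (subst (length rs <_) (quotient-length x c d P)
          (root-bound (quotient x (c ∷ d ∷ P)) (quotient-leading x c d P lead) rs u
                      (quotient-roots rs x∉rs roots)))
    where
    quotient-roots : ∀ ys → All (λ y → ¬ (x ≡ y)) ys → All (λ y → eval (c ∷ d ∷ P) y ≡ 0#) ys →
                     All (λ y → eval (quotient x (c ∷ d ∷ P)) y ≡ 0#) ys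
    quotient-roots []       []           []             = []
    quotient-roots (y ∷ ys) (x≢y ∷ x≢ys) (Py≡0 ∷ roots) =
      cancelˡ (y - x) y-x≢0 (trans factor (sym (zeroʳ _))) ∷ quotient-roots ys x≢ys roots
      where
      y-x≢0 : ¬ (y - x ≡ 0#)
      y-x≢0 y-x≡0 = x≢y (sym (begin
        y              ≡⟨ solve 2 (λ y x → y := (y :- x) :+ x) refl y x ⟩
        (y - x) + x    ≡⟨ cong (_+ x) y-x≡0 ⟩
        0# + x         ≡⟨ +-identityˡ x ⟩
        x              ∎))
      factor : (y - x) * eval (quotient x (c ∷ d ∷ P)) y ≡ 0#
      factor = begin
        (y - x) * eval (quotient x (c ∷ d ∷ P)) y
          ≡⟨ sym (+-identityʳ _) ⟩
        (y - x) * eval (quotient x (c ∷ d ∷ P)) y + 0#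
          ≡⟨ cong ((y - x) * eval (quotient x (c ∷ d ∷ P)) y +_) (sym root) ⟩
        (y - x) * eval (quotient x (c ∷ d ∷ P)) y + eval (c ∷ d ∷ P) x
          ≡⟨ sym (remainder-theorem x (c ∷ d ∷ P) y) ⟩
        eval (c ∷ d ∷ P) y
          ≡⟨ Py≡0 ⟩
        0# ∎

  monomial : ℕ → Poly
  monomial zero    = 1# ∷ []
  monomial (suc n) = 0# ∷ monomial n

  eval-monomial : ∀ n x → eval (monomial n) x ≡ pow x n
  eval-monomial zero    x = trans (cong (1# +_) (zeroʳ x)) (+-identityʳ 1#)
  eval-monomial (suc n) x = trans (+-identityˡ _) (cong (x *_) (eval-monomial n x))

  length-monomial : ∀ n → length (monomial n) ≡ suc n
  length-monomial zero    = refl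
  length-monomial (suc n) = cong suc (length-monomial n)

  monomial-leading : ∀ n → LeadingNonzero (monomial n)
  monomial-leading zero          = 1≢0
  monomial-leading (suc zero)    = 1≢0
  monomial-leading (suc (suc n)) = monomial-leading (suc n)

  _⊕_ : Poly → Poly → Poly
  []      ⊕ Q       = Q
  (a ∷ P) ⊕ []      = a ∷ P
  (a ∷ P) ⊕ (b ∷ Q) = (a + b) ∷ (P ⊕ Q)

  eval-⊕ : ∀ P Q x → eval (P ⊕ Q) x ≡ eval P x + eval Q x
  eval-⊕ []      Q       x = sym (+-identityˡ _)
  eval-⊕ (a ∷ P) []      x = sym (+-identityʳ _)
  eval-⊕ (a ∷ P) (b ∷ Q) x = trans (cong (λ w → (a + b) + x * w) (eval-⊕ P Q x))
    (solve 5 (λ a b x u v → (a :+ b) :+ x :* (u :+ v) := (a :+ x :* u) :+ (b :+ x :* v))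
           refl a b x (eval P x) (eval Q x))

  length-⊕ : ∀ P Q → length Q < length P → length (P ⊕ Q) ≡ length P
  length-⊕ (a ∷ P) []      _       = refl
  length-⊕ (a ∷ P) (b ∷ Q) (s≤s l) = cong suc (length-⊕ P Q l)

  ⊕-leading : ∀ P Q → length Q < length P → LeadingNonzero P → LeadingNonzero (P ⊕ Q)
  ⊕-leading (a ∷ P)     []          _       lead = lead
  ⊕-leading (a ∷ c ∷ P) (b ∷ [])    (s≤s l) lead = lead
  ⊕-leading (a ∷ c ∷ P) (b ∷ d ∷ Q) (s≤s l) lead = ⊕-leading (c ∷ P) (d ∷ Q) l lead

module Counting (F : FiniteField) where
  open FieldArithmetic F
  open import Data.Nat using (zero; suc)
  open import Data.Fin using (zero; suc)
  import Data.Fin.Properties as FinP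
  open import Data.Fin.Permutation using (Permutation; permutation)
  open import Data.List using (map; allFin)
  import Data.List.Properties as LP
  import Data.List.Relation.Unary.Unique.Propositional.Properties as UP
  import Data.List.Membership.Propositional.Properties as MP
  open import Relation.Binary.PropositionalEquality
  open import Relation.Nullary using (yes; no)
  open import Function.Bundles using (Inverse; Injection)
  open import Function.Properties.Inverse using (↔⇒↣; ↔-sym)
  open import Algebra.Bundles using (CommutativeRing)
  import Algebra.Properties.CommutativeMonoid.Sum as MonoidSum
  open ≡-Reasoning

  private
    module Sum = MonoidSum (CommutativeRing.+-commutativeMonoid ring)
    module Prod = MonoidSum (CommutativeRing.*-commutativeMonoid ring)
    from : Fin size → Carrier
    from = Inverse.from enum
    to : Carrier → Fin size
    to = Inverse.to enum
    from-to : ∀ x → from (to x) ≡ x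
    from-to = Inverse.strictlyInverseʳ enum
    to-from : ∀ i → to (from i) ≡ i
    to-from = Inverse.strictlyInverseˡ enum

  elements : List Carrier
  elements = map from (allFin size)

  elements-unique : Unique elements
  elements-unique = UP.map⁺ (Injection.injective (↔⇒↣ (↔-sym enum))) (UP.allFin⁺ size)

  ∈-elements : ∀ x → x ∈ elements
  ∈-elements x = subst (_∈ elements) (from-to x) (MP.∈-map⁺ from (MP.∈-allFin (to x)))

  length-elements : length elements ≡ size
  length-elements = trans (LP.length-map from (allFin size)) (LP.length-tabulate (λ i → i))

  size≢1 : ¬ (size ≡ 1)
  size≢1 size≡1 = 0≢1 (Injection.injective (↔⇒↣ enum) (all-equal size≡1 (to 0#) (to 1#)))
    where
    all-equal : ∀ {k} → k ≡ 1 → (i j : Fin k) → i ≡ j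
    all-equal refl zero zero = refl

  ΣF ΠF : (Carrier → Carrier) → Carrier
  ΣF G = Sum.sum (λ i → G (from i))
  ΠF G = Prod.sum (λ i → G (from i))

  private
    permutationOf : (h h⁻¹ : Carrier → Carrier) →
                    (∀ x → h (h⁻¹ x) ≡ x) → (∀ x → h⁻¹ (h x) ≡ x) → Permutation size size
    permutationOf h h⁻¹ hh⁻¹ h⁻¹h = permutation (λ i → to (h (from i))) (λ i → to (h⁻¹ (from i)))
      (λ i → trans (cong (λ z → to (h z)) (from-to _)) (trans (cong to (hh⁻¹ _)) (to-from i)))
      (λ i → trans (cong (λ z → to (h⁻¹ z)) (from-to _)) (trans (cong to (h⁻¹h _)) (to-from i)))

  ΣF-reindex : ∀ G (h h⁻¹ : Carrier → Carrier) →
               (∀ x → h (h⁻¹ x) ≡ x) → (∀ x → h⁻¹ (h x) ≡ x) → ΣF G ≡ ΣF (λ x → G (h x))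
  ΣF-reindex G h h⁻¹ hh⁻¹ h⁻¹h =
    trans (Sum.∑-permute (λ i → G (from i)) (permutationOf h h⁻¹ hh⁻¹ h⁻¹h))
          (Sum.sum-cong-≗ (λ i → cong G (from-to (h (from i)))))

  ΠF-reindex : ∀ G (h h⁻¹ : Carrier → Carrier) →
               (∀ x → h (h⁻¹ x) ≡ x) → (∀ x → h⁻¹ (h x) ≡ x) → ΠF G ≡ ΠF (λ x → G (h x))
  ΠF-reindex G h h⁻¹ hh⁻¹ h⁻¹h =
    trans (Prod.∑-permute (λ i → G (from i)) (permutationOf h h⁻¹ hh⁻¹ h⁻¹h))
          (Prod.sum-cong-≗ (λ i → cong G (from-to (h (from i)))))

  -- q·1 = 0: translating by 1 permutes F, so  Σ x = Σ (x + 1) = Σ x + q·1.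
  size·1≡0 : ι size ≡ 0#
  size·1≡0 = begin
    ι size                               ≡⟨ solve 2 (λ s y → y := (s :+ y) :- s) refl S (ι size) ⟩
    (S + ι size) - S                     ≡⟨ cong (λ z → (S + z) - S) (sym (sum-ones size)) ⟩
    (S + Sum.sum {size} (λ _ → 1#)) - S  ≡⟨ cong (_- S) (sym (Sum.∑-distrib-+ from (λ _ → 1#))) ⟩
    ΣF (λ x → x + 1#) - S                ≡⟨ cong (_- S) (sym (ΣF-reindex (λ x → x) (_+ 1#) (_- 1#)
                                                                         -1+1 +1-1)) ⟩
    S - S                                ≡⟨ -‿inverseʳ S ⟩
    0#                                   ∎
    where
    S = ΣF (λ x → x)
    sum-ones : ∀ n → Sum.sum {n} (λ _ → 1#) ≡ ι n
    sum-ones zero    = refl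
    sum-ones (suc n) = cong (1# +_) (sum-ones n)
    -1+1 : ∀ x → (x - 1#) + 1# ≡ x
    -1+1 x = solve 2 (λ x o → (x :- o) :+ o := x) refl x 1#
    +1-1 : ∀ x → (x + 1#) - 1# ≡ x
    +1-1 x = solve 2 (λ x o → (x :+ o) :- o := x) refl x 1#

  -- With  ν x = x for x ≠ 0 and ν 0 = 1,  scaling by a ≠ 0 permutes F
  -- and  ν (a x) = κ x · ν x  where κ x = a for x ≠ 0, κ 0 = 1.  Comparing the
  -- products gives Π κ = 1, while  a · Π κ = a^q.
  private
    ν : Carrier → Carrier
    ν x with x ≟ 0#
    ... | yes _ = 1#
    ... | no  _ = x

    κ : Carrier → Carrier → Carrier
    κ a x with x ≟ 0#
    ... | yes _ = 1#
    ... | no  _ = a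

    ν-nonzero : ∀ x → ¬ (ν x ≡ 0#)
    ν-nonzero x with x ≟ 0#
    ... | yes _   = 1≢0
    ... | no  x≢0 = x≢0

    ν-scale : ∀ a → ¬ (a ≡ 0#) → ∀ x → ν (a * x) ≡ κ a x * ν x
    ν-scale a a≢0 x with x ≟ 0# | (a * x) ≟ 0#
    ... | yes _   | yes _    = sym (*-identityˡ 1#)
    ... | yes x≡0 | no ax≢0  = ⊥-elim (ax≢0 (trans (cong (a *_) x≡0) (zeroʳ a)))
    ... | no  x≢0 | yes ax≡0 = ⊥-elim (*-nonzero a≢0 x≢0 ax≡0)
    ... | no  _   | no  _    = refl

    product-nonzero : ∀ n (f : Fin n → Carrier) → (∀ i → ¬ (f i ≡ 0#)) → ¬ (Prod.sum f ≡ 0#)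
    product-nonzero zero    f f≢0 = 1≢0
    product-nonzero (suc n) f f≢0 =
      *-nonzero (f≢0 zero) (product-nonzero n (λ i → f (suc i)) (λ i → f≢0 (suc i)))

    product-all-but-one : ∀ n a (f : Fin n → Carrier) (i₀ : Fin n) → f i₀ ≡ 1# →
                          (∀ i → ¬ (i ≡ i₀) → f i ≡ a) → a * Prod.sum f ≡ pow a n
    product-all-but-one (suc n) a f zero f₀≡1 f≡a = begin
      a * (f zero * Π-rest)   ≡⟨ cong (λ z → a * (z * Π-rest)) f₀≡1 ⟩
      a * (1# * Π-rest)       ≡⟨ cong (a *_) (*-identityˡ _) ⟩
      a * Π-rest              ≡⟨ cong (a *_) (product-constant n (λ i → f≡a (suc i) (λ ()))) ⟩
      pow a (suc n)           ∎
      where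
      Π-rest : Carrier
      Π-rest = Prod.sum (λ i → f (suc i))
      product-constant : ∀ n {g : Fin n → Carrier} → (∀ i → g i ≡ a) → Prod.sum g ≡ pow a n
      product-constant zero    g≡a = refl
      product-constant (suc n) g≡a = cong₂ _*_ (g≡a zero) (product-constant n (λ i → g≡a (suc i)))
    product-all-but-one (suc n) a f (suc i₀) f₀≡1 f≡a =
      trans (cong (λ z → a * (z * Prod.sum (λ i → f (suc i)))) (f≡a zero (λ ())))
            (cong (a *_) (product-all-but-one n a (λ i → f (suc i)) i₀ f₀≡1
                            (λ i i≢i₀ → f≡a (suc i) (λ e → i≢i₀ (FinP.suc-injective e)))))

  -- (for a = 0: the index of 0 in Fin size shows size ≠ 0, so 0^size = 0)
  fermat : ∀ a → pow a size ≡ a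
  fermat a with a ≟ 0# | to 0#
  ... | yes refl | zero  = zeroˡ _
  ... | yes refl | suc _ = zeroˡ _
  ... | no  a≢0  | _ = begin
    pow a size   ≡⟨ sym (product-all-but-one size a (λ i → κ a (from i)) (to 0#)
                                             κ-at-0 κ-elsewhere) ⟩
    a * ΠF (κ a) ≡⟨ cong (a *_) Πκ≡1 ⟩
    a * 1#       ≡⟨ *-identityʳ a ⟩
    a            ∎
    where
    κ-at-0 : κ a (from (to 0#)) ≡ 1#
    κ-at-0 rewrite from-to 0# with 0# ≟ 0#
    ... | yes _   = refl
    ... | no  0≢0 = ⊥-elim (0≢0 refl)
    κ-elsewhere : ∀ i → ¬ (i ≡ to 0#) → κ a (from i) ≡ a
    κ-elsewhere i i≢0 with from i ≟ 0#
    ... | yes fi≡0 = ⊥-elim (i≢0 (trans (sym (to-from i)) (cong to fi≡0)))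
    ... | no  _    = refl
    Πν≡Πκ·Πν : ΠF ν ≡ ΠF (κ a) * ΠF ν
    Πν≡Πκ·Πν = begin
      ΠF ν                          ≡⟨ ΠF-reindex ν (a *_) (inv a a≢0 *_)
                                                  (*-inv-cancel a a≢0) (inv-*-cancel a a≢0) ⟩
      ΠF (λ x → ν (a * x))          ≡⟨ Prod.sum-cong-≗ (λ i → ν-scale a a≢0 (from i)) ⟩
      ΠF (λ x → κ a x * ν x)        ≡⟨ Prod.∑-distrib-+ (λ i → κ a (from i)) (λ i → ν (from i)) ⟩
      ΠF (κ a) * ΠF ν               ∎
    Πκ≡1 : ΠF (κ a) ≡ 1#
    Πκ≡1 = sym (cancelˡ (ΠF ν) (product-nonzero size _ (λ i → ν-nonzero (from i)))
                 (trans (*-identityʳ _) (trans Πν≡Πκ·Πν (*-comm _ _))))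

-- The freshman's dream: if p is prime and p·1 = 0 then (x + y)^p = x^p + y^p,
-- because in the binomial expansion every coefficient except the outer two is
-- a multiple of p.
module FreshmansDream (F : FiniteField) where
  open FieldArithmetic F
  open BinomialDivisibility using (prime∣binomial)
  open import Data.Nat using (zero; suc; _<_; z≤n; s≤s)
  import Data.Nat.Properties as NP
  open import Data.Nat.Divisibility using (divides)
  open import Data.Nat.Combinatorics using (_C_; nCn≡1)
  open import Data.Fin using (zero; suc; inject₁; fromℕ)
  import Data.Fin.Properties as FinP
  open import Relation.Binary.PropositionalEquality
  open import Algebra.Bundles using (CommutativeRing)
  import Algebra.Properties.CommutativeSemiring.Binomial (CommutativeRing.commutativeSemiring ring)
    as Binomial
  open import Algebra.Properties.Semiring.Exp (CommutativeRing.semiring ring)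
    using () renaming (_^_ to _^ᴿ_)
  open import Algebra.Properties.Semiring.Mult (CommutativeRing.semiring ring)
    using () renaming (_×_ to _·ᴺ_)
  import Algebra.Properties.CommutativeMonoid.Sum (CommutativeRing.+-commutativeMonoid ring) as Sum
  open ≡-Reasoning

  pow≡^ᴿ : ∀ z m → pow z m ≡ z ^ᴿ m
  pow≡^ᴿ z zero    = refl
  pow≡^ᴿ z (suc m) = cong (z *_) (pow≡^ᴿ z m)

  ·ᴺ≡ι* : ∀ m z → m ·ᴺ z ≡ ι m * z
  ·ᴺ≡ι* zero    z = sym (zeroˡ z)
  ·ᴺ≡ι* (suc m) z = trans (cong₂ _+_ (sym (*-identityˡ z)) (·ᴺ≡ι* m z)) (sym (distribʳ _ _ _))

  sum-zero : ∀ m (f : Fin m → Carrier) → (∀ i → f i ≡ 0#) → Sum.sum f ≡ 0#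
  sum-zero zero    f f≡0 = refl
  sum-zero (suc m) f f≡0 =
    trans (cong₂ _+_ (f≡0 zero) (sum-zero m (λ i → f (suc i)) (λ i → f≡0 (suc i)))) (+-identityˡ 0#)

  inner-term≡0 : ∀ {n} → Prime n → ι n ≡ 0# → ∀ k → 0 < k → k < n → ∀ z → (n C k) ·ᴺ z ≡ 0#
  inner-term≡0 {n} n-prime n·1≡0 k 0<k k<n z with prime∣binomial n-prime k 0<k k<n
  ... | divides c nCk≡c·n = begin
    (n C k) ·ᴺ z       ≡⟨ ·ᴺ≡ι* (n C k) z ⟩
    ι (n C k) * z      ≡⟨ cong (λ t → ι t * z) nCk≡c·n ⟩
    ι (c N.* n) * z    ≡⟨ cong (_* z) (ι-* c n) ⟩
    (ι c * ι n) * z    ≡⟨ cong (λ t → (ι c * t) * z) n·1≡0 ⟩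
    (ι c * 0#) * z     ≡⟨ cong (_* z) (zeroʳ _) ⟩
    0# * z             ≡⟨ zeroˡ z ⟩
    0#                 ∎

  first-term : ∀ n x y → Binomial.binomialTerm x y n zero ≡ pow y n
  first-term n x y = trans (+-identityʳ _) (trans (*-identityˡ _) (sym (pow≡^ᴿ y n)))

  last-term : ∀ n x y → Binomial.binomialTerm x y n (fromℕ n) ≡ pow x n
  last-term n x y = top (toℕ (fromℕ n)) (FinP.toℕ-fromℕ n)
    where
    top : ∀ k → k ≡ n → (n C k) ·ᴺ (x ^ᴿ k * y ^ᴿ (n N.∸ k)) ≡ pow x n
    top .n refl = begin
      (n C n) ·ᴺ (x ^ᴿ n * y ^ᴿ (n N.∸ n))  ≡⟨ cong₂ (λ a b → a ·ᴺ (x ^ᴿ n * y ^ᴿ b))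
                                                      (nCn≡1 n) (NP.n∸n≡0 n) ⟩
      (x ^ᴿ n * 1#) + 0#                    ≡⟨ trans (+-identityʳ _) (*-identityʳ _) ⟩
      x ^ᴿ n                                ≡⟨ sym (pow≡^ᴿ x n) ⟩
      pow x n                               ∎

  freshman : ∀ {n} → Prime n → ι n ≡ 0# → ∀ x y → pow (x + y) n ≡ pow x n + pow y n
  freshman {suc (suc r)} n-prime n·1≡0 x y = begin
    pow (x + y) n                         ≡⟨ pow≡^ᴿ (x + y) n ⟩
    (x + y) ^ᴿ n                          ≡⟨ Binomial.theorem n x y ⟩
    T zero + Sum.sum (λ i → T (suc i))    ≡⟨ cong (T zero +_) (Sum.sum-init-last (λ i → T (suc i))) ⟩
    T zero + (Sum.sum inner + T (fromℕ n)) ≡⟨ cong (λ w → T zero + (w + T (fromℕ n)))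
                                                   (sum-zero (suc r) inner inner≡0) ⟩
    T zero + (0# + T (fromℕ n))           ≡⟨ cong₂ (λ a b → a + (0# + b))
                                                   (first-term n x y) (last-term n x y) ⟩
    pow y n + (0# + pow x n)              ≡⟨ trans (cong (pow y n +_) (+-identityˡ _)) (+-comm _ _) ⟩
    pow x n + pow y n                     ∎
    where
    n : ℕ
    n = suc (suc r)
    T : Fin (suc n) → Carrier
    T = Binomial.binomialTerm x y n
    inner : Fin (suc r) → Carrier
    inner i = T (suc (inject₁ i))
    inner≡0 : ∀ i → inner i ≡ 0#
    inner≡0 i = inner-term≡0 n-prime n·1≡0 (suc (toℕ (inject₁ i))) (s≤s z≤n)
      (s≤s (subst (_< suc r) (sym (FinP.toℕ-inject₁ i)) (FinP.toℕ<n i))) _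

module PrimeField (F : FiniteField) {p : ℕ} (p-prime : Prime p)
                  (p·1≡0 : FiniteField.ι F p ≡ FiniteField.0# F) where
  open FieldArithmetic F
  open Polynomials F
  open import Data.Nat using (zero; suc; _<_; z≤n; s≤s; nonTrivial⇒n>1)
  import Data.Nat.Properties as NP
  open import Data.Nat.Coprimality using (prime⇒coprime; coprime-Bézout)
  open import Data.Nat.GCD using (module Bézout)
  open import Data.Fin using (fromℕ<)
  import Data.Fin.Properties as FinP
  open import Data.List using ([]; _∷_; applyUpTo)
  import Data.List.Properties as LP
  open import Data.List.Relation.Unary.All as All using (All; _∷_)
  open import Data.List.Relation.Unary.AllPairs using (_∷_)
  import Data.List.Relation.Unary.Unique.Propositional.Properties as UP
  import Data.List.Membership.Propositional.Properties as MP
  open import Data.Nat.Primality using (prime⇒nonTrivial)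
  open import Data.Empty using (⊥)
  open import Relation.Binary.PropositionalEquality
  open import Relation.Nullary using (yes; no)
  open import Data.List.Membership.DecPropositional _≟_ using (_∈?_)
  open ≡-Reasoning

  1<p : 1 < p
  1<p = nonTrivial⇒n>1 p {{prime⇒nonTrivial p-prime}}

  0<p : 0 < p
  0<p = NP.<-trans (s≤s z≤n) 1<p

  frobenius-+ : ∀ x y → pow (x + y) p ≡ pow x p + pow y p
  frobenius-+ = FreshmansDream.freshman F p-prime p·1≡0

  frobenius-neg : ∀ x → pow (- x) p ≡ - pow x p
  frobenius-neg x = x+y≡0⇒y≡-x (begin
    pow x p + pow (- x) p   ≡⟨ sym (frobenius-+ x (- x)) ⟩
    pow (x - x) p           ≡⟨ cong (λ w → pow w p) (-‿inverseʳ x) ⟩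
    pow 0# p                ≡⟨ pow-0# 0<p ⟩
    0#                      ∎)
    where
    x+y≡0⇒y≡-x : ∀ {x y} → x + y ≡ 0# → y ≡ - x
    x+y≡0⇒y≡-x {x} {y} x+y≡0 = begin
      y              ≡⟨ solve 2 (λ x y → y := (x :+ y) :- x) refl x y ⟩
      (x + y) - x    ≡⟨ cong (_- x) x+y≡0 ⟩
      0# - x         ≡⟨ +-identityˡ _ ⟩
      - x            ∎

  frobenius-iterate-+ : ∀ i x y → pow (x + y) (p N.^ i) ≡ pow x (p N.^ i) + pow y (p N.^ i)
  frobenius-iterate-+ zero    x y = trans (pow-one _) (sym (cong₂ _+_ (pow-one x) (pow-one y)))
  frobenius-iterate-+ (suc i) x y = begin
    pow (x + y) (p N.* p N.^ i)                              ≡⟨ pow-* (x + y) p (p N.^ i) ⟩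
    pow (pow (x + y) (p N.^ i)) p                            ≡⟨ cong (λ w → pow w p) (frobenius-iterate-+ i x y) ⟩
    pow (pow x (p N.^ i) + pow y (p N.^ i)) p                ≡⟨ frobenius-+ _ _ ⟩
    pow (pow x (p N.^ i)) p + pow (pow y (p N.^ i)) p        ≡⟨ sym (cong₂ _+_ (pow-* x p (p N.^ i))
                                                                               (pow-* y p (p N.^ i))) ⟩
    pow x (p N.* p N.^ i) + pow y (p N.* p N.^ i)            ∎

  Fixed : Carrier → Set
  Fixed x = pow x p ≡ x

  fixed-+ : ∀ {a b} → Fixed a → Fixed b → Fixed (a + b)
  fixed-+ fa fb = trans (frobenius-+ _ _) (cong₂ _+_ fa fb)

  fixed-* : ∀ {a b} → Fixed a → Fixed b → Fixed (a * b)
  fixed-* fa fb = trans (pow-distrib-* _ _ p) (cong₂ _*_ fa fb)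

  fixed-neg : ∀ {a} → Fixed a → Fixed (- a)
  fixed-neg fa = trans (frobenius-neg _) (cong -_ fa)

  fixed-inv : ∀ {c} (c≢0 : ¬ (c ≡ 0#)) → Fixed c → Fixed (inv c c≢0)
  fixed-inv {c} c≢0 fc = cancelˡ c c≢0 (begin
    c * pow c⁻¹ p          ≡⟨ cong (_* pow c⁻¹ p) (sym fc) ⟩
    pow c p * pow c⁻¹ p    ≡⟨ sym (pow-distrib-* c c⁻¹ p) ⟩
    pow (c * c⁻¹) p        ≡⟨ cong (λ w → pow w p) (inv-r c c≢0) ⟩
    pow 1# p               ≡⟨ pow-1# p ⟩
    1#                     ≡⟨ sym (inv-r c c≢0) ⟩
    c * c⁻¹                ∎)
    where c⁻¹ = inv c c≢0

  ι-fixed : ∀ k → Fixed (ι k)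
  ι-fixed zero    = pow-0# 0<p
  ι-fixed (suc k) = trans (frobenius-+ 1# (ι k)) (cong₂ _+_ (pow-1# p) (ι-fixed k))

  fixed-iterate : ∀ {c} → Fixed c → ∀ i → pow c (p N.^ i) ≡ c
  fixed-iterate {c} fc zero    = pow-one c
  fixed-iterate {c} fc (suc i) =
    trans (pow-* c p (p N.^ i)) (trans (cong (λ w → pow w p) (fixed-iterate fc i)) fc)

  -- 0·1, …, (p−1)·1 are distinct: k·1 ≠ 0 for 0 < k < p, because a Bézout
  -- relation  1 + s a = t b  between k and p would give 1 = 0.
  private
    no-unit-combination : ∀ a b s t → ι a ≡ 0# → ι b ≡ 0# → 1 N.+ s N.* a ≡ t N.* b → ⊥
    no-unit-combination a b s t a·1≡0 b·1≡0 eq = 1≢0 (begin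
      1#                   ≡⟨ sym (trans (cong (1# +_) (zeroʳ _)) (+-identityʳ 1#)) ⟩
      1# + ι s * 0#        ≡⟨ cong (λ z → 1# + ι s * z) (sym a·1≡0) ⟩
      1# + ι s * ι a       ≡⟨ sym (cong (1# +_) (ι-* s a)) ⟩
      ι (1 N.+ s N.* a)    ≡⟨ cong ι eq ⟩
      ι (t N.* b)          ≡⟨ ι-* t b ⟩
      ι t * ι b            ≡⟨ cong (ι t *_) b·1≡0 ⟩
      ι t * 0#             ≡⟨ zeroʳ _ ⟩
      0#                   ∎)

  ι-nonzero : ∀ k → 0 < k → k < p → ¬ (ι k ≡ 0#)
  ι-nonzero k@(suc _) 0<k k<p k·1≡0 with coprime-Bézout (prime⇒coprime p-prime k<p)
  ... | Bézout.+- s t 1+tk≡sp = no-unit-combination k p t s k·1≡0 p·1≡0 1+tk≡sp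
  ... | Bézout.-+ s t 1+sp≡tk = no-unit-combination p k s t p·1≡0 k·1≡0 1+sp≡tk

  ι-distinct : ∀ {i j} → i < j → j < p → ¬ (ι i ≡ ι j)
  ι-distinct {i} {j} i<j j<p ιi≡ιj =
    ι-nonzero (j N.∸ i) (NP.m<n⇒0<n∸m i<j) (NP.≤-<-trans (NP.m∸n≤m j i) j<p) (begin
      ι (j N.∸ i)                  ≡⟨ solve 2 (λ a b → b := (a :+ b) :- a) refl (ι i) (ι (j N.∸ i)) ⟩
      (ι i + ι (j N.∸ i)) - ι i    ≡⟨ cong (_- ι i) (sym (ι-+ i (j N.∸ i))) ⟩
      ι (i N.+ (j N.∸ i)) - ι i    ≡⟨ cong (λ n → ι n - ι i) (NP.m+[n∸m]≡n (NP.<⇒≤ i<j)) ⟩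
      ι j - ι i                    ≡⟨ cong (_- ι i) (sym ιi≡ιj) ⟩
      ι i - ι i                    ≡⟨ -‿inverseʳ _ ⟩
      0#                           ∎)

  Xᵖ-X : Poly
  Xᵖ-X = monomial p ⊕ (0# ∷ - 1# ∷ [])

  private
    -X-shorter : length (0# ∷ - 1# ∷ []) < length (monomial p)
    -X-shorter = subst (2 <_) (sym (length-monomial p)) (s≤s 1<p)

  length-Xᵖ-X : length Xᵖ-X ≡ suc p
  length-Xᵖ-X = trans (length-⊕ (monomial p) _ -X-shorter) (length-monomial p)

  Xᵖ-X-leading : LeadingNonzero Xᵖ-X
  Xᵖ-X-leading = ⊕-leading (monomial p) _ -X-shorter (monomial-leading p)

  Xᵖ-X-root : ∀ y → Fixed y → eval Xᵖ-X y ≡ 0#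
  Xᵖ-X-root y fy = begin
    eval Xᵖ-X y                                ≡⟨ eval-⊕ (monomial p) _ y ⟩
    eval (monomial p) y + (0# + y * (- 1# + y * 0#))
                                               ≡⟨ cong₂ _+_ (trans (eval-monomial p y) fy) (-X-value y) ⟩
    y - y                                      ≡⟨ -‿inverseʳ y ⟩
    0#                                         ∎
    where
    -X-value : ∀ y → 0# + y * (- 1# + y * 0#) ≡ - y
    -X-value y = begin
      0# + y * (- 1# + y * 0#)   ≡⟨ cong (λ w → 0# + y * (- 1# + w)) (zeroʳ y) ⟩
      0# + y * (- 1# + 0#)       ≡⟨ trans (+-identityˡ _) (cong (y *_) (+-identityʳ _)) ⟩
      y * - 1#                   ≡⟨ sym (-‿distribʳ-* y 1#) ⟩
      - (y * 1#)                 ≡⟨ cong -_ (*-identityʳ y) ⟩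
      - y                        ∎

  multiples : List Carrier
  multiples = applyUpTo ι p

  prime-field⇒∈multiples : ∀ {x} → InPrimeField p x → x ∈ multiples
  prime-field⇒∈multiples (k , refl) = MP.∈-applyUpTo⁺ ι (FinP.toℕ<n k)

  -- Conversely every fixed element is some k·1 with k < p: otherwise X^p − X
  -- would have the p + 1 distinct roots  x, 0·1, …, (p−1)·1.
  fixed⇒prime-field : ∀ x → Fixed x → InPrimeField p x
  fixed⇒prime-field x fx with x ∈? multiples
  ... | yes x∈ with MP.∈-applyUpTo⁻ ι x∈
  ...   | k , k<p , x≡ιk = fromℕ< k<p , trans x≡ιk (cong ι (sym (FinP.toℕ-fromℕ< k<p)))
  fixed⇒prime-field x fx | no x∉ =
    ⊥-elim (NP.<-irrefl (cong suc (LP.length-applyUpTo ι p))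
             (subst (length (x ∷ multiples) <_) length-Xᵖ-X
               (root-bound Xᵖ-X Xᵖ-X-leading (x ∷ multiples) distinct roots)))
    where
    distinct : Unique (x ∷ multiples)
    distinct = All.tabulate (λ y∈ x≡y → x∉ (subst (_∈ multiples) (sym x≡y) y∈))
             ∷ UP.applyUpTo⁺₁ ι p ι-distinct
    roots : All (λ y → eval Xᵖ-X y ≡ 0#) (x ∷ multiples)
    roots = Xᵖ-X-root x fx ∷ All.tabulate (λ y∈ → let (k , _ , y≡ιk) = MP.∈-applyUpTo⁻ ι y∈
                                                 in Xᵖ-X-root _ (subst Fixed (sym y≡ιk) (ι-fixed k)))

module Trace (F : FiniteField) {p : ℕ} (p-prime : Prime p) (n : ℕ)
             (size≡ : FiniteField.size F ≡ p ^ N.suc n) where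
  open FieldArithmetic F
  open Polynomials F
  open Counting F
  open ListCounting
  open import Data.Nat using (zero; suc; _<_; s≤s)
  import Data.Nat.Properties as NP
  open import Data.Nat.Primality using (prime⇒nonZero)
  open import Data.Product using (proj₁; proj₂)
  open import Data.Product.Properties using (,-injective)
  open import Data.List using ([]; map; filter; cartesianProduct)
  import Data.List.Properties as LP
  open import Data.List.Relation.Unary.All as All using (All)
  open import Data.List.Relation.Unary.Any as Any using (any?)
  import Data.List.Relation.Unary.Unique.Propositional.Properties as UP
  import Data.List.Membership.Propositional.Properties as MP
  open import Relation.Binary.PropositionalEquality
  open import Relation.Nullary using (yes; no; ¬?)
  open import Function.Bundles using (mk⇔; Equivalence)
  open ≡-Reasoning

  -- |F| = p^(n+1) forces characteristic p:  (p·1)^(n+1) = q·1 = 0.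
  p·1≡0 : ι p ≡ 0#
  p·1≡0 = pow≡0⇒≡0 (suc n) (trans (sym (ι-pow p (suc n))) (trans (cong ι (sym size≡)) size·1≡0))

  open PrimeField F p-prime p·1≡0 public

  fermat′ : ∀ u → pow u (p ^ suc n) ≡ u
  fermat′ u = subst (λ e → pow u e ≡ u) size≡ (fermat u)

  tr : Carrier → Carrier
  tr = Tr p (suc n)

  Tr-+ : ∀ i x y → Tr p i (x + y) ≡ Tr p i x + Tr p i y
  Tr-+ zero    x y = sym (+-identityˡ 0#)
  Tr-+ (suc i) x y = trans (cong₂ _+_ (Tr-+ i x y) (frobenius-iterate-+ i x y))
    (solve 4 (λ a b c d → (a :+ b) :+ (c :+ d) := (a :+ c) :+ (b :+ d)) refl _ _ _ _)

  Tr-- : ∀ i x y → Tr p i (x - y) ≡ Tr p i x - Tr p i y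
  Tr-- i x y = begin
    Tr p i (x - y)                                ≡⟨ solve 2 (λ a b → a := (a :+ b) :- b) refl _ (Tr p i y) ⟩
    (Tr p i (x - y) + Tr p i y) - Tr p i y        ≡⟨ cong (_- Tr p i y) (sym (Tr-+ i (x - y) y)) ⟩
    Tr p i ((x - y) + y) - Tr p i y               ≡⟨ cong (λ w → Tr p i w - Tr p i y)
                                                         (solve 2 (λ x y → (x :- y) :+ y := x) refl x y) ⟩
    Tr p i x - Tr p i y                           ∎

  Tr-scale : ∀ {c} → Fixed c → ∀ i u → Tr p i (c * u) ≡ c * Tr p i u
  Tr-scale fc zero    u = sym (zeroʳ _)
  Tr-scale {c} fc (suc i) u = begin
    Tr p i (c * u) + pow (c * u) (p ^ i)   ≡⟨ cong₂ _+_ (Tr-scale fc i u)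
                                                 (trans (pow-distrib-* c u (p ^ i))
                                                        (cong (_* pow u (p ^ i)) (fixed-iterate fc i))) ⟩
    c * Tr p i u + c * pow u (p ^ i)       ≡⟨ sym (distribˡ _ _ _) ⟩
    c * (Tr p i u + pow u (p ^ i))         ∎

  -- (Tr_i u)^p = Tr_i u − u + u^(p^i); for i = n + 1 Fermat makes the trace fixed.
  private
    Tr-frobenius : ∀ i u → pow (Tr p i u) p + u ≡ Tr p i u + pow u (p ^ i)
    Tr-frobenius zero    u = trans (cong (_+ u) (ι-fixed 0)) (cong (0# +_) (sym (pow-one u)))
    Tr-frobenius (suc i) u = begin
      pow (Tr p i u + pow u (p ^ i)) p + u
        ≡⟨ cong (_+ u) (frobenius-+ _ _) ⟩
      (pow (Tr p i u) p + pow (pow u (p ^ i)) p) + u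
        ≡⟨ solve 3 (λ a b c → (a :+ b) :+ c := (a :+ c) :+ b) refl _ _ _ ⟩
      (pow (Tr p i u) p + u) + pow (pow u (p ^ i)) p
        ≡⟨ cong₂ _+_ (Tr-frobenius i u) (sym (pow-* u p (p ^ i))) ⟩
      (Tr p i u + pow u (p ^ i)) + pow u (p ^ suc i) ∎

  Tr-fixed : ∀ u → Fixed (tr u)
  Tr-fixed u = begin
    pow t p                    ≡⟨ solve 2 (λ a u → a := (a :+ u) :- u) refl _ u ⟩
    (pow t p + u) - u          ≡⟨ cong (_- u) (Tr-frobenius (suc n) u) ⟩
    (t + pow u (p ^ suc n)) - u ≡⟨ cong (λ w → (t + w) - u) (fermat′ u) ⟩
    (t + u) - u                ≡⟨ solve 2 (λ a u → (a :+ u) :- u := a) refl t u ⟩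
    t                          ∎
    where t = tr u

  trace-poly : ℕ → Poly
  trace-poly zero    = []
  trace-poly (suc i) = monomial (p ^ i) ⊕ trace-poly i

  eval-trace-poly : ∀ i u → eval (trace-poly i) u ≡ Tr p i u
  eval-trace-poly zero    u = refl
  eval-trace-poly (suc i) u = trans (eval-⊕ (monomial (p ^ i)) (trace-poly i) u)
    (trans (cong₂ _+_ (eval-monomial (p ^ i) u) (eval-trace-poly i u)) (+-comm _ _))

  private
    pⁱ<pⁱ⁺¹ : ∀ i → p ^ i < p ^ suc i
    pⁱ<pⁱ⁺¹ i = NP.^-monoʳ-< p 1<p (NP.n<1+n i)

  trace-poly-shape : ∀ i → length (trace-poly (suc i)) ≡ suc (p ^ i) ×
                           LeadingNonzero (trace-poly (suc i))
  trace-poly-shape zero    = length-monomial 1 , monomial-leading 1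
  trace-poly-shape (suc i) =
    trans (length-⊕ (monomial (p ^ suc i)) (trace-poly (suc i)) shorter) (length-monomial (p ^ suc i)) ,
    ⊕-leading (monomial (p ^ suc i)) (trace-poly (suc i)) shorter (monomial-leading (p ^ suc i))
    where
    shorter : length (trace-poly (suc i)) < length (monomial (p ^ suc i))
    shorter = subst₂ _<_ (sym (proj₁ (trace-poly-shape i))) (sym (length-monomial (p ^ suc i)))
                     (s≤s (pⁱ<pⁱ⁺¹ i))

  -- The trace is not identically zero: a polynomial of degree p^n < q cannot
  -- vanish on all q elements.
  trace-nonzero : ∃ λ w → ¬ (tr w ≡ 0#)
  trace-nonzero with any? (λ w → ¬? (tr w ≟ 0#)) elements
  ... | yes some = Any.satisfied some
  ... | no none  = ⊥-elim (NP.<-irrefl refl (NP.<-≤-trans (pⁱ<pⁱ⁺¹ n) (N.s≤s⁻¹ too-many-roots)))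
    where
    all-roots : All (λ w → eval (trace-poly (suc n)) w ≡ 0#) elements
    all-roots = All.tabulate λ {w} w∈ → trans (eval-trace-poly (suc n) w) (vanishes w w∈)
      where
      vanishes : ∀ w → w ∈ elements → tr w ≡ 0#
      vanishes w w∈ with tr w ≟ 0#
      ... | yes t≡0 = t≡0
      ... | no  t≢0 = ⊥-elim (none (lose w∈ t≢0))
        where open import Data.List.Membership.Propositional using (lose)
    too-many-roots : p ^ suc n < suc (p ^ n)
    too-many-roots = subst₂ _<_ (trans length-elements size≡) (proj₁ (trace-poly-shape n))
      (root-bound (trace-poly (suc n)) (proj₂ (trace-poly-shape n)) elements elements-unique all-roots)

  -- An element of trace 1: rescale an element w of nonzero trace by Tr(w)⁻¹ ∈ GF(p).
  w₀ : Carrier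
  w₀ = inv (tr w) tr-w≢0 * w
    where open Σ trace-nonzero renaming (proj₁ to w; proj₂ to tr-w≢0)

  tr-w₀ : tr w₀ ≡ 1#
  tr-w₀ = trans (Tr-scale (fixed-inv tr-w≢0 (Tr-fixed w)) (suc n) w)
                (trans (*-comm _ _) (inv-r _ tr-w≢0))
    where open Σ trace-nonzero renaming (proj₁ to w; proj₂ to tr-w≢0)

  tr-along-w₀ : ∀ {c} → Fixed c → tr (c * w₀) ≡ c
  tr-along-w₀ {c} fc = trans (Tr-scale fc (suc n) w₀) (trans (cong (c *_) tr-w₀) (*-identityʳ c))

  kernel-part : ∀ u → tr (u - tr u * w₀) ≡ 0#
  kernel-part u = trans (Tr-- (suc n) u (tr u * w₀))
                        (trans (cong (λ t → tr u - t) (tr-along-w₀ (Tr-fixed u))) (-‿inverseʳ (tr u)))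

  kernel : List Carrier
  kernel = filter (λ u → tr u ≟ 0#) elements

  kernel-unique : Unique kernel
  kernel-unique = UP.filter⁺ (λ u → tr u ≟ 0#) elements-unique

  ∈-kernel : ∀ {u} → u ∈ kernel ⇔ (tr u ≡ 0#)
  ∈-kernel {u} = mk⇔ (λ u∈ → proj₂ (MP.∈-filter⁻ (λ u → tr u ≟ 0#) {xs = elements} u∈))
                     (MP.∈-filter⁺ (λ u → tr u ≟ 0#) (∈-elements u))

  -- For a list xs and a GF(p)-valued c, the pairs (x , v) with x ∈ xs and
  -- Tr v = c x, listed as  v = u + c(x)·w₀  with u in the kernel; in particular
  -- each fibre has |ker Tr| elements.
  translate : (Carrier → Carrier) → Carrier × Carrier → Carrier × Carrier
  translate c (x , u) = x , u + c x * w₀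

  fibres : (Carrier → Carrier) → List Carrier → List (Carrier × Carrier)
  fibres c xs = map (translate c) (cartesianProduct xs kernel)

  fibres-unique : ∀ c {xs} → Unique xs → Unique (fibres c xs)
  fibres-unique c xs-unique = UP.map⁺ injective (UP.cartesianProduct⁺ xs-unique kernel-unique)
    where
    injective : ∀ {xu xu′ : Carrier × Carrier} → translate c xu ≡ translate c xu′ → xu ≡ xu′
    injective {x , u} {x′ , u′} eq with ,-injective eq
    ... | refl , u+t≡u′+t = cong (x ,_) (+-cancelʳ (c x * w₀) u+t≡u′+t)

  length-fibres : ∀ c xs → length (fibres c xs) ≡ length xs N.* length kernel
  length-fibres c xs = trans (LP.length-map (translate c) (cartesianProduct xs kernel))
                             (length-cartesianProduct xs kernel)

  ∈-fibres : ∀ c {xs} → (∀ {x} → x ∈ xs → Fixed (c x)) →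
             ∀ {x v} → (x , v) ∈ fibres c xs ⇔ (x ∈ xs × tr v ≡ c x)
  ∈-fibres c {xs} c-fixed {x} {v} = mk⇔ to from
    where
    to : (x , v) ∈ fibres c xs → x ∈ xs × tr v ≡ c x
    to xv∈ with MP.∈-map⁻ (translate c) xv∈
    ... | (x , u) , xu∈ , refl with MP.∈-cartesianProduct⁻ xs kernel xu∈
    ...   | x∈ , u∈ = x∈ , (begin
      tr (u + c x * w₀)        ≡⟨ Tr-+ (suc n) u (c x * w₀) ⟩
      tr u + tr (c x * w₀)     ≡⟨ cong₂ _+_ (Equivalence.to ∈-kernel u∈) (tr-along-w₀ (c-fixed x∈)) ⟩
      0# + c x                 ≡⟨ +-identityˡ _ ⟩
      c x                      ∎)
    from : x ∈ xs × tr v ≡ c x → (x , v) ∈ fibres c xs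
    from (x∈ , tr-v≡cx) = subst (_∈ fibres c xs) (cong (x ,_) v-split)
      (MP.∈-map⁺ (translate c) (MP.∈-cartesianProduct⁺ x∈ (Equivalence.from ∈-kernel kernel-v)))
      where
      v-split : (v - c x * w₀) + c x * w₀ ≡ v
      v-split = solve 2 (λ v t → (v :- t) :+ t := v) refl v (c x * w₀)
      kernel-v : tr (v - c x * w₀) ≡ 0#
      kernel-v = subst (λ t → tr (v - t * w₀) ≡ 0#) tr-v≡cx (kernel-part v)

  -- The graph {(Tr v , v)} of the trace lists every element of F once ...
  graph : List (Carrier × Carrier)
  graph = map (λ v → tr v , v) elements

  graph-unique : Unique graph
  graph-unique = UP.map⁺ (λ eq → proj₂ (,-injective eq)) elements-unique

  -- ... and has the same members as the fibres over 0·1, …, (p−1)·1.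
  ∈-graph : ∀ {xv} → xv ∈ graph ⇔ xv ∈ fibres (λ x → x) multiples
  ∈-graph {x , v} = mk⇔ to from
    where
    multiples-fixed : ∀ {x} → x ∈ multiples → Fixed x
    multiples-fixed x∈ with MP.∈-applyUpTo⁻ ι x∈
    ... | k , _ , refl = ι-fixed k
    to : (x , v) ∈ graph → (x , v) ∈ fibres (λ x → x) multiples
    to xv∈ with MP.∈-map⁻ (λ v → tr v , v) xv∈
    ... | v , _ , refl = Equivalence.from (∈-fibres (λ x → x) multiples-fixed)
      (prime-field⇒∈multiples (fixed⇒prime-field (tr v) (Tr-fixed v)) , refl)
    from : (x , v) ∈ fibres (λ x → x) multiples → (x , v) ∈ graph
    from xv∈ = subst (λ t → (t , v) ∈ graph)
                     (proj₂ (Equivalence.to (∈-fibres (λ x → x) multiples-fixed) xv∈))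
                     (MP.∈-map⁺ (λ v → tr v , v) (∈-elements v))

  -- Hence q = p·|ker Tr|, i.e. |ker Tr| = p^n.
  length-kernel : length kernel ≡ p ^ n
  length-kernel = NP.*-cancelˡ-≡ (length kernel) (p ^ n) p (begin
    p N.* length kernel                  ≡⟨ cong (N._* length kernel) (sym (LP.length-applyUpTo ι p)) ⟩
    length multiples N.* length kernel   ≡⟨ sym (length-fibres (λ x → x) multiples) ⟩
    length (fibres (λ x → x) multiples)  ≡⟨ sym (same-members⇒same-length graph-unique
                                                   (fibres-unique (λ x → x) (UP.applyUpTo⁺₁ ι p ι-distinct))
                                                   ∈-graph) ⟩
    length graph                         ≡⟨ LP.length-map _ elements ⟩
    length elements                      ≡⟨ trans length-elements size≡ ⟩
    p ^ suc n                            ∎)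
    where instance _ = prime⇒nonZero p-prime

  trace-nondegenerate : ∀ d → (∀ w → tr (d * w) ≡ 0#) → d ≡ 0#
  trace-nondegenerate d vanishes with d ≟ 0#
  ... | yes d≡0 = d≡0
  ... | no  d≢0 = ⊥-elim (1≢0 (trans (sym tr-w₀) (trans (cong tr (sym (*-inv-cancel d d≢0 w₀)))
                                                          (vanishes (inv d d≢0 * w₀)))))

module Stabiliser (F : FiniteField) {p : ℕ} (p-prime : Prime p) (n : ℕ)
                  (size≡ : FiniteField.size F ≡ p ^ N.suc n) where
  open FieldArithmetic F
  open Trace F p-prime n size≡
  open import Data.Nat using (zero; suc; _<_; z≤n; s≤s)
  import Data.Nat.Properties as NP
  open import Data.Nat.Primality using (prime⇒nonZero)
  open import Data.Fin using (fromℕ<)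
  import Data.Fin.Properties as FinP
  open import Data.List using (applyUpTo)
  import Data.List.Properties as LP
  import Data.List.Relation.Unary.Unique.Propositional.Properties as UP
  import Data.List.Membership.Propositional.Properties as MP
  open import Data.Product using (proj₂)
  open import Relation.Binary.PropositionalEquality
  open import Function.Bundles using (mk⇔; Equivalence)
  open ≡-Reasoning

  -- An affine map that maps B_j into itself maps ker Tr into itself: compare
  -- the images of u₀ = j·w₀ and u₀ + w.
  preserves-kernel : ∀ {j a b} → Fixed j →
                     (∀ u → InB p (suc n) j u → InB p (suc n) j (a * u + b)) →
                     ∀ w → tr w ≡ 0# → tr (a * w) ≡ 0#
  preserves-kernel {j} {a} {b} fj maps-into w tr-w≡0 = begin
    tr (a * w)                                ≡⟨ cong tr difference ⟩
    tr ((a * (u₀ + w) + b) - (a * u₀ + b))    ≡⟨ Tr-- (suc n) _ _ ⟩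
    tr (a * (u₀ + w) + b) - tr (a * u₀ + b)   ≡⟨ cong₂ _-_ (maps-into (u₀ + w) tr-u₀+w) (maps-into u₀ tr-u₀) ⟩
    j - j                                     ≡⟨ -‿inverseʳ j ⟩
    0#                                        ∎
    where
    u₀ : Carrier
    u₀ = j * w₀
    difference : a * w ≡ (a * (u₀ + w) + b) - (a * u₀ + b)
    difference = solve 4 (λ a u w b → a :* w := (a :* (u :+ w) :+ b) :- (a :* u :+ b))
                         refl a u₀ w b
    tr-u₀ : tr u₀ ≡ j
    tr-u₀ = tr-along-w₀ fj
    tr-u₀+w : tr (u₀ + w) ≡ j
    tr-u₀+w = trans (Tr-+ (suc n) u₀ w) (trans (cong₂ _+_ tr-u₀ tr-w≡0) (+-identityʳ j))

  -- If multiplication by a preserves ker Tr, then a ∈ GF(p): writing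
  -- c = Tr(a w₀), the splitting of w along w₀ gives Tr(a w) = c · Tr w, so
  -- Tr((a − c) w) = 0 for all w and a = c by nondegeneracy.
  kernel-preserving⇒fixed : ∀ a → (∀ w → tr w ≡ 0# → tr (a * w) ≡ 0#) → Fixed a
  kernel-preserving⇒fixed a preserves = subst Fixed (sym a≡c) (Tr-fixed (a * w₀))
    where
    c : Carrier
    c = tr (a * w₀)
    tr-aw : ∀ w → tr (a * w) ≡ c * tr w
    tr-aw w = begin
      tr (a * w)                                        ≡⟨ cong tr split ⟩
      tr (a * (w - tr w * w₀) + tr w * (a * w₀))        ≡⟨ Tr-+ (suc n) _ _ ⟩
      tr (a * (w - tr w * w₀)) + tr (tr w * (a * w₀))   ≡⟨ cong₂ _+_ (preserves _ (kernel-part w))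
                                                                   (Tr-scale (Tr-fixed w) (suc n) (a * w₀)) ⟩
      0# + tr w * c                                     ≡⟨ trans (+-identityˡ _) (*-comm _ _) ⟩
      c * tr w                                          ∎
      where
      split : a * w ≡ a * (w - tr w * w₀) + tr w * (a * w₀)
      split = solve 4 (λ a w t w₀ → a :* w := a :* (w :- t :* w₀) :+ t :* (a :* w₀))
                      refl a w (tr w) w₀
    a≡c : a ≡ c
    a≡c = +-cancelʳ (- c) (trans (trace-nondegenerate (a - c) λ w → begin
      tr ((a - c) * w)                  ≡⟨ cong tr (solve 3 (λ a c w → (a :- c) :* w := a :* w :- c :* w)
                                                              refl a c w) ⟩
      tr (a * w - c * w)                ≡⟨ Tr-- (suc n) _ _ ⟩
      tr (a * w) - tr (c * w)           ≡⟨ cong₂ _-_ (tr-aw w) (Tr-scale (Tr-fixed (a * w₀)) (suc n) w) ⟩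
      c * tr w - c * tr w               ≡⟨ -‿inverseʳ _ ⟩
      0#                                ∎) (sym (-‿inverseʳ c)))

  -- The characterisation:  x ↦ a x + b stabilises B_j  iff  a ∈ GF(p)* and Tr b = j − j a.
  -- Forward: a ∈ GF(p) as above, and then  j = Tr(a u₀ + b) = a j + Tr b.
  stabiliser-forward : ∀ {j a b} → Fixed j → InStabiliser p (suc n) j (a , b) →
                       Fixed a × tr b ≡ j - j * a
  stabiliser-forward {j} {a} {b} fj (_ , maps-into , _) = fa , (begin
    tr b                                  ≡⟨ solve 2 (λ x y → y := (x :+ y) :- x) refl (tr (a * u₀)) (tr b) ⟩
    (tr (a * u₀) + tr b) - tr (a * u₀)    ≡⟨ cong₂ _-_ tr-image tr-au₀ ⟩
    j - a * j                             ≡⟨ cong (λ t → j - t) (*-comm a j) ⟩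
    j - j * a                             ∎)
    where
    u₀ : Carrier
    u₀ = j * w₀
    fa : Fixed a
    fa = kernel-preserving⇒fixed a (preserves-kernel fj maps-into)
    tr-image : tr (a * u₀) + tr b ≡ j
    tr-image = trans (sym (Tr-+ (suc n) _ _)) (maps-into u₀ (tr-along-w₀ fj))
    tr-au₀ : tr (a * u₀) ≡ a * j
    tr-au₀ = trans (Tr-scale fa (suc n) u₀) (cong (a *_) (tr-along-w₀ fj))

  -- Backward: Tr(a u + b) = a Tr(u) + j − j a, and u ↦ a u + b is invertible.
  stabiliser-backward : ∀ {j a b} → ¬ (a ≡ 0#) → Fixed a → tr b ≡ j - j * a →
                        Stabilises p (suc n) j a b
  stabiliser-backward {j} {a} {b} a≢0 fa tr-b = maps-into , onto
    where
    tr-affine : ∀ u → tr (a * u + b) ≡ a * tr u + (j - j * a)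
    tr-affine u = trans (Tr-+ (suc n) _ _) (cong₂ _+_ (Tr-scale fa (suc n) u) tr-b)
    maps-into : ∀ u → InB p (suc n) j u → InB p (suc n) j (a * u + b)
    maps-into u tr-u = begin
      tr (a * u + b)             ≡⟨ tr-affine u ⟩
      a * tr u + (j - j * a)     ≡⟨ cong (λ t → a * t + (j - j * a)) tr-u ⟩
      a * j + (j - j * a)        ≡⟨ solve 2 (λ a j → a :* j :+ (j :- j :* a) := j) refl a j ⟩
      j                          ∎
    onto : ∀ v → InB p (suc n) j v → ∃ λ u → InB p (suc n) j u × a * u + b ≡ v
    onto v tr-v = u , cancelˡ a a≢0 a·tr-u , a·u+b≡v
      where
      u : Carrier
      u = inv a a≢0 * (v - b)
      a·u+b≡v : a * u + b ≡ v
      a·u+b≡v = trans (cong (_+ b) (*-inv-cancel a a≢0 (v - b)))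
                      (solve 2 (λ v b → (v :- b) :+ b := v) refl v b)
      a·tr-u : a * tr u ≡ a * j
      a·tr-u = +-cancelʳ (j - j * a) (begin
        a * tr u + (j - j * a)     ≡⟨ sym (tr-affine u) ⟩
        tr (a * u + b)             ≡⟨ cong tr a·u+b≡v ⟩
        tr v                       ≡⟨ tr-v ⟩
        j                          ≡⟨ solve 2 (λ a j → j := a :* j :+ (j :- j :* a)) refl a j ⟩
        a * j + (j - j * a)        ∎)

  stabiliser-characterisation : ∀ {j} → Fixed j → (a b : Carrier) →
    InStabiliser p (suc n) j (a , b) ⇔
    (¬ (a ≡ 0#) × InPrimeField p a × InB p (suc n) (j - j * a) b)
  stabiliser-characterisation fj a b = mk⇔
    (λ st@(a≢0 , _) → let (fa , tr-b) = stabiliser-forward fj st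
                      in a≢0 , fixed⇒prime-field a fa , tr-b)
    (λ (a≢0 , (k , a≡ιk) , tr-b) →
       a≢0 , stabiliser-backward a≢0 (subst Fixed (sym a≡ιk) (ι-fixed (toℕ k))) tr-b)

  units : List Carrier
  units = applyUpTo (λ k → ι (suc k)) (p N.∸ 1)

  private
    instance _ = prime⇒nonZero p-prime
    1+[p∸1]≡p : suc (p N.∸ 1) ≡ p
    1+[p∸1]≡p = NP.suc-pred p

    <p∸1⇒1+<p : ∀ {k} → k < p N.∸ 1 → suc k < p
    <p∸1⇒1+<p k< = subst (suc _ <_) 1+[p∸1]≡p (s≤s k<)

  units-unique : Unique units
  units-unique = UP.applyUpTo⁺₁ _ (p N.∸ 1) λ i<j j< → ι-distinct (s≤s i<j) (<p∸1⇒1+<p j<)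

  ∈-units : ∀ {a} → a ∈ units ⇔ (¬ (a ≡ 0#) × InPrimeField p a)
  ∈-units {a} = mk⇔ to from
    where
    to : a ∈ units → ¬ (a ≡ 0#) × InPrimeField p a
    to a∈ with MP.∈-applyUpTo⁻ (λ k → ι (suc k)) a∈
    ... | k , k< , refl = ι-nonzero (suc k) (s≤s z≤n) (<p∸1⇒1+<p k<) ,
                          fromℕ< (<p∸1⇒1+<p k<) , cong ι (sym (FinP.toℕ-fromℕ< (<p∸1⇒1+<p k<)))
    from : ¬ (a ≡ 0#) × InPrimeField p a → a ∈ units
    from (a≢0 , i , refl) with toℕ i in eq
    ... | zero  = ⊥-elim (a≢0 refl)
    ... | suc k = MP.∈-applyUpTo⁺ (λ k → ι (suc k)) (N.s<s⁻¹ (subst (_< suc (p N.∸ 1)) eq i<1+[p∸1]))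
      where
      i<1+[p∸1] : toℕ i < suc (p N.∸ 1)
      i<1+[p∸1] = subst (toℕ i <_) (sym 1+[p∸1]≡p) (FinP.toℕ<n i)

  stabiliser : Carrier → List (Carrier × Carrier)
  stabiliser j = fibres (λ a → j - j * a) units

  stabiliser-unique : ∀ j → Unique (stabiliser j)
  stabiliser-unique j = fibres-unique _ units-unique

  length-stabiliser : ∀ j → length (stabiliser j) ≡ (p N.∸ 1) N.* p ^ n
  length-stabiliser j = trans (length-fibres _ units)
                              (cong₂ N._*_ (LP.length-applyUpTo _ (p N.∸ 1)) length-kernel)

  ∈-stabiliser : ∀ {j} → Fixed j → ∀ g → g ∈ stabiliser j ⇔ InStabiliser p (suc n) j g
  ∈-stabiliser {j} fj (a , b) = mk⇔
    (λ g∈ → let (a∈ , tr-b) = Equivalence.to (∈-fibres _ offset-fixed) g∈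
                (a≢0 , a-prime) = Equivalence.to ∈-units a∈
            in Equivalence.from (stabiliser-characterisation fj a b) (a≢0 , a-prime , tr-b))
    (λ st → let (a≢0 , a-prime , tr-b) = Equivalence.to (stabiliser-characterisation fj a b) st
            in Equivalence.from (∈-fibres _ offset-fixed)
                                (Equivalence.from ∈-units (a≢0 , a-prime) , tr-b))
    where
    offset-fixed : ∀ {a} → a ∈ units → Fixed (j - j * a)
    offset-fixed {a} a∈ with proj₂ (Equivalence.to ∈-units a∈)
    ... | k , refl = fixed-+ fj (fixed-neg (fixed-* fj (ι-fixed (toℕ k))))

-- The theorem.  |F| = p^0 = 1 is impossible in a field; for m = n + 1 the two
-- parts are the characterisation and the explicit list of the stabiliser.
theorem23 : (p m : ℕ) → Prime p → (F : FiniteField) → FiniteField.size F ≡ p ^ m →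
    (k : Fin p) →
    let open FiniteField F
        j = ι (toℕ k)
    in ((a b : Carrier) →
          InStabiliser p m j (a , b) ⇔
          (¬ (a ≡ 0#) × InPrimeField p a × InB p m (j - j * a) b))
       × (∃ λ (xs : List (Carrier × Carrier)) →
            Unique xs × length xs ≡ (p N.∸ 1) N.* p ^ (m N.∸ 1) ×
            ((g : Carrier × Carrier) → g ∈ xs ⇔ InStabiliser p m j g))
theorem23 p N.zero    p-prime F size≡ k = ⊥-elim (Counting.size≢1 F size≡)
theorem23 p (N.suc n) p-prime F size≡ k =
  stabiliser-characterisation j-fixed ,
  (stabiliser _ , stabiliser-unique _ , length-stabiliser _ , ∈-stabiliser j-fixed)
  where
  open Stabiliser F p-prime n size≡
  open Trace F p-prime n size≡ using (Fixed; ι-fixed)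
  j-fixed : Fixed (FiniteField.ι F (toℕ k))
  j-fixed = ι-fixed (toℕ k)
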